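{- In $\mathbf{Graph}$, with $\mathcal{M}$ the class of all monomorphisms, AGREE $\not\prec$ PBPO: there exists an AGREE rule $\rho$ such that there is no PBPO rule $\tau$ with $\Rightarrow^{\rho}_{\mathrm{AGREE}}=\Rightarrow^{\tau}_{\mathrm{PBPO}}$.
   Context: $\mathbf{Graph}$ is the category whose objects are directed multigraphs labeled over a fixed label set (unlabeled if it is a singleton) and whose morphisms are label-preserving graph homomorphisms. It has a mono-partial map classifier $(T,\eta)$: a functor $T$ and natural transformation $\eta:\mathrm{Id}\to T$ with each $\eta_X$ mono, such that for every span $A\xleftarrow{m}X\xrightarrow{f}B$ with $m$ mono there is a unique $[m,f]:A\to T(B)$ with $\eta_B\circ f=[m,f]\circ m$ a pullback. AGREE rule $\rho$: a span $L\xleftarrow{l}K\xrightarrow{r}R$ with a mono $t_K:K\to K'$. AGREE step with a mono match $m:L\to G_L$: $G_L\xleftarrow{g_L}G_K\to K'$ is a pullback of $G_L\xrightarrow{[m,1_L]}T(L)\xleftarrow{[t_K,l]}K'$, $u:K\to G_K$ is induced, and $G_R$ is a pushout of $G_K\xleftarrow{u}K\xrightarrow{r}R$. PBPO rule $\tau$: spans $L\xleftarrow{l}K\xrightarrow{r}R$ and $L'\xleftarrow{l'}K'\xrightarrow{r'}R'$ with $t_L,t_K,t_R$ making both squares commute. PBPO step with $m:L\to G_L$, $\alpha:G_L\to L'$: $t_L=\alpha m$, $G_L\xleftarrow{g_L}G_K\xrightarrow{u'}K'$ a pullback of $\alpha,l'$, $u$ induced with $g_Lu=ml$, $u'u=t_K$,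 $G_R$ a pushout of $u,r$. In each formalism $\Rightarrow^{\rho}$ is the union of steps over all admissible matches (and adherences). -}

module Defs where

open import Level using (0ℓ)
open import Data.Product using (Σ; Σ-syntax; _×_; _,_)
open import Data.Sum using (_⊎_; inj₁; inj₂)
open import Relation.Binary.PropositionalEquality using (_≡_; refl; sym; trans; cong)

record Graph (Λ : Set) : Set₁ where
  field
    V   : Set
    E   : Set
    src : E → V
    tgt : E → V
    lv  : V → Λ
    le  : E → Λ
open Graph public

module _ {Λ : Set} where

  record Hom (A B : Graph Λ) : Set where
    field
      fV   : V A → V B
      fE   : E A → E B
      fsrc : ∀ e → src B (fE e) ≡ fV (src A e)
      ftgt : ∀ e → tgt B (fE e) ≡ fV (tgt A e)
      flv  : ∀ v → lv B (fV v) ≡ lv A v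
      fle  : ∀ e → le B (fE e) ≡ le A e
  open Hom public

  idH : (A : Graph Λ) → Hom A A
  idH A = record
    { fV = λ v → v ; fE = λ e → e
    ; fsrc = λ _ → refl ; ftgt = λ _ → refl
    ; flv = λ _ → refl ; fle = λ _ → refl }

  infixr 9 _∘H_
  _∘H_ : {A B C : Graph Λ} → Hom B C → Hom A B → Hom A C
  _∘H_ {A} {B} {C} g f = record
    { fV = λ v → fV g (fV f v)
    ; fE = λ e → fE g (fE f e)
    ; fsrc = λ e → trans (fsrc g (fE f e)) (cong (fV g) (fsrc f e))
    ; ftgt = λ e → trans (ftgt g (fE f e)) (cong (fV g) (ftgt f e))
    ; flv = λ v → trans (flv g (fV f v)) (flv f v)
    ; fle = λ e → trans (fle g (fE f e)) (fle f e) }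

  infix 4 _≈H_
  _≈H_ : {A B : Graph Λ} → Hom A B → Hom A B → Set
  f ≈H g = (∀ v → fV f v ≡ fV g v) × (∀ e → fE f e ≡ fE g e)

  Mono : {A B : Graph Λ} → Hom A B → Set₁
  Mono {A} {B} f = (X : Graph Λ) (g h : Hom X A) → f ∘H g ≈H f ∘H h → g ≈H h

  IsPullback : {A B C P : Graph Λ} → Hom A C → Hom B C → Hom P A → Hom P B → Set₁
  IsPullback {A} {B} {C} {P} f g p₁ p₂ =
    (f ∘H p₁ ≈H g ∘H p₂) ×
    ((X : Graph Λ) (a : Hom X A) (b : Hom X B) → f ∘H a ≈H g ∘H b →
      Σ[ h ∈ Hom X P ] ((p₁ ∘H h ≈H a) × (p₂ ∘H h ≈H b) ×
        ((h' : Hom X P) → p₁ ∘H h' ≈H a → p₂ ∘H h' ≈H b → h' ≈H h)))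

  IsPushout : {A B C Q : Graph Λ} → Hom C A → Hom C B → Hom A Q → Hom B Q → Set₁
  IsPushout {A} {B} {C} {Q} f g q₁ q₂ =
    (q₁ ∘H f ≈H q₂ ∘H g) ×
    ((X : Graph Λ) (a : Hom A X) (b : Hom B X) → a ∘H f ≈H b ∘H g →
      Σ[ h ∈ Hom Q X ] ((h ∘H q₁ ≈H a) × (h ∘H q₂ ≈H b) ×
        ((h' : Hom Q X) → h' ∘H q₁ ≈H a → h' ∘H q₂ ≈H b → h' ≈H h)))

  -- The mono-partial map classifier (T, η) of Graph (object part).

  TV : Graph Λ → Set
  TV B = V B ⊎ Λ

  T : Graph Λ → Graph Λ
  T B = record
    { V = TV B
    ; E = E B ⊎ (TV B × TV B × Λ)
    ; src = λ { (inj₁ e) → inj₁ (src B e) ; (inj₂ (x , y , λ')) → x }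
    ; tgt = λ { (inj₁ e) → inj₁ (tgt B e) ; (inj₂ (x , y , λ')) → y }
    ; lv = λ { (inj₁ v) → lv B v ; (inj₂ λ') → λ' }
    ; le = λ { (inj₁ e) → le B e ; (inj₂ (x , y , λ')) → λ' } }

  η : (B : Graph Λ) → Hom B (T B)
  η B = record
    { fV = inj₁ ; fE = inj₁
    ; fsrc = λ _ → refl ; ftgt = λ _ → refl
    ; flv = λ _ → refl ; fle = λ _ → refl }

  -- φ is the classifying map [m , f] of the span A <-m- X -f-> B (m mono):
  -- the square  η B ∘ f = φ ∘ m  is a pullback.  By the classifier
  -- property such φ exists and is unique, so this characterises [m , f].
  IsClassifying : {X A B : Graph Λ} → Hom X A → Hom X B → Hom A (T B) → Set₁
  IsClassifying {X} {A} {B} m f φ = IsPullback φ (η B) m f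

  record AGREERule : Set₁ where
    field
      L K R K' : Graph Λ
      l  : Hom K L
      r  : Hom K R
      tK : Hom K K'
      tK-mono : Mono tK

  AGREEStep : AGREERule → Graph Λ → Graph Λ → Set₁
  AGREEStep ρ GL GR =
    let open AGREERule ρ in
    Σ[ m ∈ Hom L GL ] Mono m ×
    Σ[ φ ∈ Hom GL (T L) ] IsClassifying m (idH L) φ ×
    Σ[ ψ ∈ Hom K' (T L) ] IsClassifying tK l ψ ×
    Σ[ GK ∈ Graph Λ ] Σ[ gL ∈ Hom GK GL ] Σ[ g ∈ Hom GK K' ]
      IsPullback φ ψ gL g ×
    Σ[ u ∈ Hom K GK ] (gL ∘H u ≈H m ∘H l) × (g ∘H u ≈H tK) ×
    Σ[ gR ∈ Hom GK GR ] Σ[ w ∈ Hom R GR ] IsPushout u r gR w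

  record PBPORule : Set₁ where
    field
      L K R L' K' R' : Graph Λ
      l  : Hom K L
      r  : Hom K R
      l' : Hom K' L'
      r' : Hom K' R'
      tL : Hom L L'
      tK : Hom K K'
      tR : Hom R R'
      comm-l : tL ∘H l ≈H l' ∘H tK
      comm-r : tR ∘H r ≈H r' ∘H tK

  PBPOStep : PBPORule → Graph Λ → Graph Λ → Set₁
  PBPOStep τ GL GR =
    let open PBPORule τ in
    Σ[ m ∈ Hom L GL ] Mono m ×
    Σ[ α ∈ Hom GL L' ] (α ∘H m ≈H tL) ×
    Σ[ GK ∈ Graph Λ ] Σ[ gL ∈ Hom GK GL ] Σ[ u' ∈ Hom GK K' ]
      IsPullback α l' gL u' ×
    Σ[ u ∈ Hom K GK ] (gL ∘H u ≈H m ∘H l) × (u' ∘H u ≈H tK) ×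
    Σ[ gR ∈ Hom GK GR ] Σ[ w ∈ Hom R GR ] IsPushout u r gR w

  SameRelation : (Graph Λ → Graph Λ → Set₁) → (Graph Λ → Graph Λ → Set₁) → Set₁
  SameRelation P Q = (G H : Graph Λ) → (P G H → Q G H) × (Q G H → P G H)

{-# OPTIONS --safe #-}
module Submission where

-- The AGREE rule ρ matches one λ₀-node, with K = R = ∅ and K' a single λ₀-node.  Its
-- classifying map [t_K , l] sends that node to the fresh λ₀-vertex of T L, so a step
-- deletes the match and every edge but keeps every other λ₀-node: ρ rewrites one
-- point to ∅, but not two points.  In PBPO a step to ∅ forces G_K to be empty, and
-- then the step can be transported along any retract G_L ⇄ G'_L by precomposing the
-- adherence with the retraction; one point is a retract of two points.

open import Defs
open import Data.Bool using (Bool; true; not)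
open import Data.Bool.Properties using (not-¬)
open import Data.Empty using (⊥; ⊥-elim)
open import Data.Product using (Σ; Σ-syntax; _×_; _,_; proj₁; proj₂)
open import Data.Sum using (inj₁; inj₂)
open import Data.Sum.Properties using (inj₁-injective)
open import Data.Unit using (⊤; tt)
open import Relation.Nullary using (¬_)
open import Relation.Binary.PropositionalEquality using (_≡_; _≢_; refl; sym; trans; cong)

module _ {Λ : Set} where

  ∘H-congˡ : {A B C : Graph Λ} (h : Hom B C) {f g : Hom A B} → f ≈H g → h ∘H f ≈H h ∘H g
  ∘H-congˡ h (fgV , fgE) = (λ v → cong (fV h) (fgV v)) , (λ e → cong (fE h) (fgE e))

  retraction⇒mono : {A B : Graph Λ} (j : Hom A B) (c : Hom B A) → c ∘H j ≈H idH A → Mono j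
  retraction⇒mono j c (cjV , cjE) X g h (eqV , eqE) =
    (λ v → trans (sym (cjV (fV g v))) (trans (cong (fV c) (eqV v)) (cjV (fV h v)))) ,
    (λ e → trans (sym (cjE (fE g e))) (trans (cong (fE c) (eqE e)) (cjE (fE h e))))

  ∘H-mono : {A B C : Graph Λ} {g : Hom B C} {f : Hom A B} → Mono g → Mono f → Mono (g ∘H f)
  ∘H-mono {f = f} g-mono f-mono X a b eq = f-mono X a b (g-mono X (f ∘H a) (f ∘H b) eq)

  -- Edges have a source, so a graph without vertices is the empty graph.
  IsEmpty : Graph Λ → Set
  IsEmpty X = ¬ V X

  ∅G : Graph Λ
  ∅G = record { V = ⊥ ; E = ⊥ ; src = λ () ; tgt = λ () ; lv = λ () ; le = λ () }

  Hom-from-empty : {X Y : Graph Λ} → IsEmpty X → Hom X Y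
  Hom-from-empty {X} noV = record
    { fV = λ v → ⊥-elim (noV v) ; fE = λ e → ⊥-elim (noV (src X e))
    ; fsrc = λ e → ⊥-elim (noV (src X e)) ; ftgt = λ e → ⊥-elim (noV (src X e))
    ; flv = λ v → ⊥-elim (noV v) ; fle = λ e → ⊥-elim (noV (src X e)) }

  ¡ : (Y : Graph Λ) → Hom ∅G Y
  ¡ Y = Hom-from-empty (λ ())

  ≈H-from-empty : {X Y : Graph Λ} → IsEmpty X → (f g : Hom X Y) → f ≈H g
  ≈H-from-empty {X} noV f g = (λ v → ⊥-elim (noV v)) , (λ e → ⊥-elim (noV (src X e)))

  ¡-mono : (Y : Graph Λ) → Mono (¡ Y)
  ¡-mono Y X g h _ = ≈H-from-empty (fV g) g h

  IsPullback-from-empty-cones : {A B C P : Graph Λ} {f : Hom A C} {g : Hom B C}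
    {p₁ : Hom P A} {p₂ : Hom P B} → IsEmpty P →
    ((X : Graph Λ) (a : Hom X A) (b : Hom X B) → f ∘H a ≈H g ∘H b → IsEmpty X) →
    IsPullback f g p₁ p₂
  IsPullback-from-empty-cones {f = f} {g} {p₁} {p₂} noP cones-empty =
    ≈H-from-empty noP (f ∘H p₁) (g ∘H p₂) ,
    λ X a b comm → let noX = cones-empty X a b comm ; h = Hom-from-empty noX in
      h , ≈H-from-empty noX (p₁ ∘H h) a , ≈H-from-empty noX (p₂ ∘H h) b ,
      λ h' _ _ → ≈H-from-empty noX h' h

  ∅-pushout : IsPushout (idH ∅G) (¡ ∅G) (idH ∅G) (idH ∅G)
  ∅-pushout = ≈H-from-empty (λ ()) (idH ∅G) (idH ∅G ∘H ¡ ∅G) ,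
    λ X a b _ → ¡ X , ≈H-from-empty (λ ()) (¡ X) a , ≈H-from-empty (λ ()) (¡ X) b ,
                λ h' _ _ → ≈H-from-empty (λ ()) h' (¡ X)

  point : Λ → Graph Λ
  point ℓ = record { V = ⊤ ; E = ⊥ ; src = λ () ; tgt = λ () ; lv = λ _ → ℓ ; le = λ () }

  twoPoints : Λ → Graph Λ
  twoPoints ℓ = record { V = Bool ; E = ⊥ ; src = λ () ; tgt = λ () ; lv = λ _ → ℓ ; le = λ () }

  pt : {A : Graph Λ} {ℓ : Λ} (v : V A) → lv A v ≡ ℓ → Hom (point ℓ) A
  pt v lbl = record
    { fV = λ _ → v ; fE = λ () ; fsrc = λ () ; ftgt = λ () ; flv = λ _ → lbl ; fle = λ () }

  collapse : (ℓ : Λ) → Hom (twoPoints ℓ) (point ℓ)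
  collapse ℓ = record
    { fV = λ _ → tt ; fE = λ () ; fsrc = λ () ; ftgt = λ () ; flv = λ _ → refl ; fle = λ () }

  collapse-retracts : (ℓ : Λ) → collapse ℓ ∘H pt true refl ≈H idH (point ℓ)
  collapse-retracts ℓ = (λ _ → refl) , (λ ())

  pullback-vertex : {A B C P : Graph Λ} {f : Hom A C} {g : Hom B C}
    {p₁ : Hom P A} {p₂ : Hom P B} → IsPullback f g p₁ p₂ →
    (a : V A) (b : V B) → fV f a ≡ fV g b →
    Σ[ x ∈ V P ] (fV p₁ x ≡ a) × (fV p₂ x ≡ b)
  pullback-vertex {A} {B} {C} {f = f} {g} (_ , universal) a b fa≡gb
    with universal (point (lv A a)) (pt a refl) (pt b labels-agree) ((λ _ → fa≡gb) , (λ ()))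
    where
    labels-agree : lv B b ≡ lv A a
    labels-agree = trans (sym (flv g b)) (trans (cong (lv C) (sym fa≡gb)) (flv f a))
  ... | h , (p₁h , _) , (p₂h , _) , _ = fV h tt , p₁h tt , p₂h tt

  classifier-outside-image : {X A B : Graph Λ} {m : Hom X A} {f : Hom X B} {φ : Hom A (T B)} →
    IsClassifying m f φ → (v : V A) → (∀ x → fV m x ≢ v) → fV φ v ≡ inj₂ (lv A v)
  classifier-outside-image {A = A} {B} {m = m} {f} {φ} cl v outside with fV φ v in φv
  ... | inj₁ b = ⊥-elim (outside _ (proj₁ (proj₂ preimage)))
    where
    preimage = pullback-vertex {f = φ} {g = η B} {p₁ = m} {p₂ = f} cl v b φv
  ... | inj₂ ℓ = cong inj₂ (trans (cong (lv (T B)) (sym φv)) (flv φ v))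

  η-classifies-idH : (B : Graph Λ) → IsClassifying (idH B) (idH B) (η B)
  η-classifies-idH B = ((λ _ → refl) , (λ _ → refl)) ,
    λ X a b (ηaV , ηaE) → a , ((λ _ → refl) , (λ _ → refl)) ,
      ((λ v → inj₁-injective (ηaV v)) , (λ e → inj₁-injective (ηaE e))) , λ h' h'a _ → h'a

  PBPOStep-to-∅-along-retract : (τ : PBPORule) {G G' : Graph Λ} (j : Hom G G') (c : Hom G' G) →
    c ∘H j ≈H idH G → PBPOStep τ G ∅G → PBPOStep τ G' ∅G
  PBPOStep-to-∅-along-retract τ j c cj
    (m , m-mono , α , αm , GK , gL , u' , pb , u , gLu , u'u , gR , w , po) =
    j ∘H m , ∘H-mono {g = j} {f = m} (retraction⇒mono j c cj) m-mono ,
    α ∘H c , adherence ,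
    GK , j ∘H gL , u' , pb' ,
    u , ∘H-congˡ j {gL ∘H u} {m ∘H l} gLu , u'u , gR , w , po
    where
    open PBPORule τ
    adherence : (α ∘H c) ∘H (j ∘H m) ≈H tL
    adherence = (λ v → trans (cong (fV α) (proj₁ cj (fV m v))) (proj₁ αm v)) ,
                (λ e → trans (cong (fE α) (proj₂ cj (fE m e))) (proj₂ αm e))
    -- gR maps G_K to ∅, and each cone over the new cospan factors through the old pullback.
    pb' : IsPullback (α ∘H c) l' (j ∘H gL) u'
    pb' = IsPullback-from-empty-cones {f = α ∘H c} {g = l'} {p₁ = j ∘H gL} {p₂ = u'} (fV gR)
      λ X a b comm x → fV gR (fV (proj₁ (proj₂ pb X (c ∘H a) b comm)) x)

  deletePoint : Λ → AGREERule
  deletePoint ℓ = record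
    { L = point ℓ ; K = ∅G ; R = ∅G ; K' = point ℓ
    ; l = ¡ (point ℓ) ; r = ¡ ∅G ; tK = ¡ (point ℓ) ; tK-mono = ¡-mono (point ℓ) }

  deletePoint-deletes-point : (ℓ : Λ) → AGREEStep (deletePoint ℓ) (point ℓ) ∅G
  deletePoint-deletes-point ℓ =
    idH P , retraction⇒mono (idH P) (idH P) ((λ _ → refl) , (λ ())) ,
    η P , η-classifies-idH P ,
    fresh , fresh-classifies-¡ ,
    ∅G , ¡ P , ¡ P , η-fresh-pullback ,
    idH ∅G , ≈H-from-empty (λ ()) (¡ P) (¡ P) , ≈H-from-empty (λ ()) (¡ P) (¡ P) ,
    idH ∅G , idH ∅G , ∅-pushout
    where
    P = point ℓ
    fresh : Hom P (T P)
    fresh = pt (inj₂ ℓ) refl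
    fresh≢η : ∀ {x} → _≡_ {A = TV P} (inj₂ ℓ) (inj₁ x) → ⊥
    fresh≢η ()
    fresh-classifies-¡ : IsClassifying (¡ P) (¡ P) fresh
    fresh-classifies-¡ = IsPullback-from-empty-cones {f = fresh} {g = η P} {p₁ = ¡ P} {p₂ = ¡ P}
      (λ ()) (λ X a b comm x → fresh≢η (proj₁ comm x))
    η-fresh-pullback : IsPullback (η P) fresh (¡ P) (¡ P)
    η-fresh-pullback = IsPullback-from-empty-cones {f = η P} {g = fresh} {p₁ = ¡ P} {p₂ = ¡ P}
      (λ ()) (λ X a b comm x → fresh≢η (sym (proj₁ comm x)))

  deletePoint-keeps-other-point : (ℓ : Λ) → ¬ AGREEStep (deletePoint ℓ) (twoPoints ℓ) ∅G
  deletePoint-keeps-other-point ℓ (m , _ , φ , clφ , ψ , clψ , _ , gL , g , pb , _ , _ , _ , gR , _) =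
    fV gR (proj₁ (pullback-vertex {f = φ} {g = ψ} {p₁ = gL} {p₂ = g} pb other tt φ-other≡ψ-tt))
    where
    other : Bool
    other = not (fV m tt)
    φ-other : fV φ other ≡ inj₂ ℓ
    φ-other = classifier-outside-image {m = m} {f = idH (point ℓ)} {φ = φ}
      clφ other (λ _ → not-¬ refl)
    ψ-tt : fV ψ tt ≡ inj₂ ℓ
    ψ-tt = classifier-outside-image {m = ¡ (point ℓ)} {f = ¡ (point ℓ)} {φ = ψ} clψ tt (λ ())
    φ-other≡ψ-tt : fV φ other ≡ fV ψ tt
    φ-other≡ψ-tt = trans φ-other (sym ψ-tt)

proposition16 : (Λ : Set) → Λ →
    Σ[ ρ ∈ AGREERule {Λ} ]
      ¬ (Σ[ τ ∈ PBPORule {Λ} ] SameRelation (AGREEStep ρ) (PBPOStep τ))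
proposition16 Λ ℓ = deletePoint ℓ , λ (τ , same) →
  deletePoint-keeps-other-point ℓ
    (proj₂ (same (twoPoints ℓ) ∅G)
      (PBPOStep-to-∅-along-retract τ (pt true refl) (collapse ℓ) (collapse-retracts ℓ)
        (proj₁ (same (point ℓ) ∅G) (deletePoint-deletes-point ℓ))))
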